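{- For any cardinal $\kappa$, the following are equivalent: (1) $\kappa<\operatorname{add}(\mathfrak{X},\mathfrak{D})$; (2) for each sequence $\langle (g_\alpha,\mathcal{F}_\alpha):\alpha<\kappa\rangle$ such that each $g_\alpha\in\mathbb{N}^{\mathbb{N}}$, each $\mathcal{F}_\alpha\subseteq[\mathbb{N}]^\infty$, and for each $\alpha$ the restriction $\mathcal{F}_\alpha\|\{n:0<g_\alpha(n)\}$ is large and linearly quasiordered by $\subseteq^*$, there exists $h\in\mathbb{N}^{\mathbb{N}}$ such that for each $\alpha<\kappa$ the restriction $\mathcal{F}_\alpha\|\{n:g_\alpha(n)\le h(n)\}$ is large.
   Context: $[\mathbb{N}]^\infty$ is the family of infinite subsets of $\mathbb{N}$; $A\subseteq^*B$ means $A\setminus B$ is finite. For $\mathcal{F}\subseteq[\mathbb{N}]^\infty$ and $A\subseteq\mathbb{N}$, $\mathcal{F}\|A=\{B\cap A:B\in\mathcal{F}\}$, called large if all its members are infinite. $\mathbb{N}^{\mathbb{N}}$ is the set of functions $\mathbb{N}\to\mathbb{N}$; $f\le^*g$ means $f(n)\le g(n)$ for all but finitely many $n$; a subset of $\mathbb{N}^{\mathbb{N}}$ is dominating if it is $\le^*$-cofinal. For $Y\subseteq\mathbb{N}^{\mathbb{N}}$, $g$ avoids middles in $Y$ if $\{n:f(n)<g(n)\}$ is infinite for each $f\in Y$, and for all $f,h\in Y$ at least one of $\{n:f(n)<g(n)\le h(n)\}$, $\{n:h(n)<g(n)\le f(n)\}$ is finite. $\mathfrak{X}$ is the class of $Y\subseteq\mathbb{N}^{\mathbb{N}}$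 for which some $g$ avoids middles in $Y$; $\mathfrak{D}$ is the class of non-dominating subsets. $\operatorname{add}(\mathfrak{X},\mathfrak{D})$ is the minimal cardinality of a family $\mathcal{F}\subseteq\mathfrak{X}$ with $\bigcup\mathcal{F}$ dominating. -}

module Defs where

open import Level using (0ℓ) renaming (suc to lsuc)
open import Data.Nat using (ℕ; _≤_; _<_)
open import Data.Bool using (Bool; true)
open import Data.Product using (Σ; _×_; _,_)
open import Data.Sum using (_⊎_)
open import Relation.Nullary using (¬_)
open import Relation.Binary.PropositionalEquality using (_≡_)
open import Function.Bundles using (_⇔_)
open import Axiom.ExcludedMiddle using (ExcludedMiddle)

Subset : Set
Subset = ℕ → Bool

FinP : (ℕ → Set) → Set
FinP P = Σ ℕ λ m → ∀ n → m ≤ n → ¬ P n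

InfP : (ℕ → Set) → Set
InfP P = ∀ m → Σ ℕ λ n → m ≤ n × P n

_∈_ : ℕ → Subset → Set
n ∈ A = A n ≡ true

Infinite : Subset → Set
Infinite A = InfP (λ n → n ∈ A)

Family : Set₁
Family = Subset → Set

AllInfinite : Family → Set
AllInfinite F = ∀ B → F B → Infinite B

-- F ∥ A is large: every B ∩ A (B ∈ F) is infinite.
Large : Family → (ℕ → Set) → Set
Large F A = ∀ B → F B → InfP (λ n → n ∈ B × A n)

_⊆*_ : (ℕ → Set) → (ℕ → Set) → Set
C ⊆* D = FinP (λ n → C n × ¬ D n)

-- F ∥ A is linearly quasiordered by ⊆* (⊆* is always a quasiorder;
-- linearity = any two members are comparable).
Linear* : Family → (ℕ → Set) → Set
Linear* F A = ∀ B B' → F B → F B' →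
  ((λ n → n ∈ B × A n) ⊆* (λ n → n ∈ B' × A n)) ⊎
  ((λ n → n ∈ B' × A n) ⊆* (λ n → n ∈ B × A n))

_≤*_ : (ℕ → ℕ) → (ℕ → ℕ) → Set
f ≤* g = Σ ℕ λ m → ∀ n → m ≤ n → f n ≤ g n

FunSet : Set₁
FunSet = (ℕ → ℕ) → Set

Dominating : FunSet → Set
Dominating Y = ∀ f → Σ (ℕ → ℕ) λ g → Y g × f ≤* g

AvoidsMiddles : (ℕ → ℕ) → FunSet → Set
AvoidsMiddles g Y =
  (∀ f → Y f → InfP (λ n → f n < g n)) ×
  (∀ f h → Y f → Y h →
     FinP (λ n → f n < g n × g n ≤ h n) ⊎ FinP (λ n → h n < g n × g n ≤ f n))

InX : FunSet → Set
InX Y = Σ (ℕ → ℕ) λ g → AvoidsMiddles g Y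

-- κ < add(𝔛,𝔇), with κ = |K|: every K-indexed family of members of 𝔛
-- (i.e. every subfamily of 𝔛 of size ≤ κ) has non-dominating union.
BelowAddXD : Set → Set₁
BelowAddXD K = (Y : K → FunSet) → (∀ k → InX (Y k)) →
  ¬ Dominating (λ f → Σ K λ k → Y k f)

Cond2 : Set → Set₁
Cond2 K = (g : K → ℕ → ℕ) (F : K → Family) →
  (∀ α → AllInfinite (F α)) →
  (∀ α → Large (F α) (λ n → 0 < g α n) × Linear* (F α) (λ n → 0 < g α n)) →
  Σ (ℕ → ℕ) λ h → ∀ α → Large (F α) (λ n → g α n ≤ h n)

-- For (2) ⇒ (1), a family Y avoided by g yields the ⊆*-linear family of sets
-- {n : f n < g n}, f ∈ Y; a function h making all of them large on {g ≤ h} is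
-- dominated by no member of Y.  For (1) ⇒ (2), each B ∈ F_α is coded by the
-- function that equals g_α − 1 on B ∩ {g_α > 0} and exceeds g_α elsewhere; these
-- codes form a family in 𝔛 whose union is not dominating, and a function escaping
-- every code, made monotone, is the required h.
module Submission where

open import Defs
open import Level using (0ℓ) renaming (suc to lsuc)
open import Function.Bundles using (_⇔_; mk⇔; Equivalence)
open import Axiom.ExcludedMiddle using (ExcludedMiddle)
open import Data.Nat using (ℕ; zero; suc; pred; _≤_; _<_; _≤′_; ≤′-refl; ≤′-step; _⊔_; _<ᵇ_; _<?_; z≤n)
open import Data.Nat.Properties
open import Data.Bool using (true; if_then_else_)
import Data.Bool as Bool
open import Data.Bool.Properties using (T-≡)
open import Data.Empty using (⊥-elim)
open import Data.Product using (Σ; _×_; _,_; proj₁; proj₂)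
open import Data.Sum using (_⊎_; inj₁; inj₂)
import Data.Sum as Sum
open import Relation.Nullary using (¬_; yes; no; does; contradiction)
open import Relation.Nullary.Decidable using (_×-dec_)
open import Relation.Unary using (Decidable)
open import Relation.Binary.PropositionalEquality using (_≡_; refl)

pred[n]<n : ∀ {n} → 0 < n → pred n < n
pred[n]<n {suc n} _ = n<1+n n

pred[m]<n⇒m≤n : ∀ {m n} → pred m < n → m ≤ n
pred[m]<n⇒m≤n {zero}  _  = z≤n
pred[m]<n⇒m≤n {suc m} lt = lt

runningMax : (ℕ → ℕ) → ℕ → ℕ
runningMax h zero    = h zero
runningMax h (suc n) = runningMax h n ⊔ h (suc n)

runningMax-≥ : ∀ h n → h n ≤ runningMax h n
runningMax-≥ h zero    = ≤-refl
runningMax-≥ h (suc n) = m≤n⊔m (runningMax h n) (h (suc n))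

runningMax-mono : ∀ h {m n} → m ≤ n → runningMax h m ≤ runningMax h n
runningMax-mono h m≤n = go (≤⇒≤′ m≤n)
  where
    go : ∀ {m n} → m ≤′ n → runningMax h m ≤ runningMax h n
    go ≤′-refl       = ≤-refl
    go (≤′-step p)   = ≤-trans (go p) (m≤m⊔n _ _)

FinP-mono : ∀ {P Q : ℕ → Set} → (∀ {n} → P n → Q n) → FinP Q → FinP P
FinP-mono P⇒Q (m , fin) = m , λ n m≤n p → fin n m≤n (P⇒Q p)

InfP-mono : ∀ {P Q : ℕ → Set} → (∀ {n} → P n → Q n) → InfP P → InfP Q
InfP-mono P⇒Q inf m with inf m
... | n , m≤n , p = n , m≤n , P⇒Q p

⊆*-mono : ∀ {C C′ D D′ : ℕ → Set} → (∀ {n} → C′ n → C n) → (∀ {n} → D n → D′ n) →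
          C ⊆* D → C′ ⊆* D′
⊆*-mono C′⇒C D⇒D′ = FinP-mono λ (c′ , ¬d′) → C′⇒C c′ , λ d → ¬d′ (D⇒D′ d)

-- A middle of f and h is a point of {f < g} outside {h < g}.
⊆*⇒finite-middles : ∀ {g f h : ℕ → ℕ} →
  (λ n → f n < g n) ⊆* (λ n → h n < g n) → FinP (λ n → f n < g n × g n ≤ h n)
⊆*⇒finite-middles = FinP-mono λ (f<g , g≤h) → f<g , ≤⇒≯ g≤h

finite-middles⇒⊆* : ∀ {g f h : ℕ → ℕ} →
  FinP (λ n → f n < g n × g n ≤ h n) → (λ n → f n < g n) ⊆* (λ n → h n < g n)
finite-middles⇒⊆* = FinP-mono λ (f<g , h≮g) → f<g , ≮⇒≥ h≮g

infinitely-between⇒≰* : ∀ {g f h : ℕ → ℕ} → InfP (λ n → f n < g n × g n ≤ h n) → ¬ h ≤* f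
infinitely-between⇒≰* inf (m , h≤f) with inf m
... | n , m≤n , f<g , g≤h = n≮n _ (<-≤-trans f<g (≤-trans g≤h (h≤f n m≤n)))

≰*⇒infinitely-> : ExcludedMiddle 0ℓ → ∀ {h f : ℕ → ℕ} → ¬ h ≤* f → InfP (λ n → f n < h n)
≰*⇒infinitely-> em {h} {f} h≰f m with em {Σ ℕ λ n → m ≤ n × f n < h n}
... | yes found = found
... | no none    = ⊥-elim (h≰f (m , λ n m≤n → ≮⇒≥ λ f<h → none (n , m≤n , f<h)))

¬dominating⇒unbounded : ExcludedMiddle 0ℓ → ∀ {Y : FunSet} →
  ¬ Dominating Y → Σ (ℕ → ℕ) λ h → ∀ f → Y f → ¬ h ≤* f
¬dominating⇒unbounded em {Y} notDom
  with em {Σ (ℕ → ℕ) λ h → ¬ Σ (ℕ → ℕ) λ f → Y f × h ≤* f}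
... | yes (h , unbounded) = h , λ f yf h≤f → unbounded (f , yf , h≤f)
... | no none = ⊥-elim (notDom λ h → dominator h)
  where
    dominator : ∀ h → Σ (ℕ → ℕ) λ f → Y f × h ≤* f
    dominator h with em {Σ (ℕ → ℕ) λ f → Y f × h ≤* f}
    ... | yes d  = d
    ... | no nod = ⊥-elim (none (h , nod))

module Below (g : ℕ → ℕ) (Y : FunSet) (avoids : AvoidsMiddles g Y) where

  below : (ℕ → ℕ) → Subset
  below f n = f n <ᵇ g n

  ∈-below : ∀ f {n} → n ∈ below f ⇔ f n < g n
  ∈-below f {n} = mk⇔ (λ e → <ᵇ⇒< (f n) (g n) (Equivalence.from T-≡ e))
                      (λ lt → Equivalence.to T-≡ (<⇒<ᵇ lt))

  belowFamily : Family
  belowFamily B = Σ (ℕ → ℕ) λ f → Y f × B ≡ below f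

  belowFamily-allInfinite : AllInfinite belowFamily
  belowFamily-allInfinite _ (f , yf , refl) =
    InfP-mono (Equivalence.from (∈-below f)) (proj₁ avoids f yf)

  belowFamily-large : Large belowFamily (λ n → 0 < g n)
  belowFamily-large _ (f , yf , refl) =
    InfP-mono (λ f<g → Equivalence.from (∈-below f) f<g , m<n⇒0<n f<g) (proj₁ avoids f yf)

  belowFamily-linear : Linear* belowFamily (λ n → 0 < g n)
  belowFamily-linear _ _ (f , yf , refl) (f′ , yf′ , refl) =
    Sum.map (transfer f f′) (transfer f′ f) (proj₂ avoids f f′ yf yf′)
    where
      transfer : ∀ f f′ → FinP (λ n → f n < g n × g n ≤ f′ n) →
        (λ n → n ∈ below f × 0 < g n) ⊆* (λ n → n ∈ below f′ × 0 < g n)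
      transfer f f′ middles =
        ⊆*-mono (λ (e , _) → Equivalence.to (∈-below f) e)
                (λ f′<g → Equivalence.from (∈-below f′) f′<g , m<n⇒0<n f′<g)
                (finite-middles⇒⊆* middles)

  large-below⇒undominated : ∀ {h} → Large belowFamily (λ n → g n ≤ h n) →
                            ∀ f → Y f → ¬ h ≤* f
  large-below⇒undominated large f yf =
    infinitely-between⇒≰* (InfP-mono (λ (e , g≤h) → Equivalence.to (∈-below f) e , g≤h)
                                     (large (below f) (f , yf , refl)))

cond2⇒belowAddXD : ∀ K → Cond2 K → BelowAddXD K
cond2⇒belowAddXD K cond2 Y inX dominating =
  let h , large = cond2 (λ k → proj₁ (inX k)) belowFamily belowFamily-allInfinite
                        (λ k → belowFamily-large k , belowFamily-linear k)
      f , (k , yf) , h≤f = dominating h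
  in large-below⇒undominated k (large k) f yf h≤f
  where open module BelowK k = Below (proj₁ (inX k)) (Y k) (proj₂ (inX k))

module Coding {S : ℕ → Set} (S? : Decidable S) (g next : ℕ → ℕ) where

  code : ℕ → ℕ
  code n = if does (S? n) then pred (g n) else g n ⊔ g (next n)

  code<g⇒S : ∀ {n} → code n < g n → S n
  code<g⇒S {n} lt with S? n
  ... | yes s = s
  ... | no _  = ⊥-elim (n≮n _ (≤-<-trans (m≤m⊔n (g n) (g (next n))) lt))

  S⇒code<g : ∀ {n} → S n → 0 < g n → code n < g n
  S⇒code<g {n} s pos with S? n
  ... | yes _ = pred[n]<n pos
  ... | no ¬s = contradiction s ¬s

  code<⇒ : ∀ {n H} → code n < H → (S n × g n ≤ H) ⊎ g (next n) < H
  code<⇒ {n} lt with S? n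
  ... | yes s = inj₁ (s , pred[m]<n⇒m≤n lt)
  ... | no _  = inj₂ (≤-<-trans (m≤n⊔m (g n) (g (next n))) lt)

module Codes (g : ℕ → ℕ) (F : Family) (large : Large F (λ n → 0 < g n))
             (linear : Linear* F (λ n → 0 < g n)) where

  Live : Subset → ℕ → Set
  Live B n = n ∈ B × 0 < g n

  live? : ∀ B → Decidable (Live B)
  live? B n = (B n Bool.≟ true) ×-dec (0 <? g n)

  nextLive : ∀ B → F B → ℕ → ℕ
  nextLive B p n = proj₁ (large B p n)

  module CodeOf B p = Coding (live? B) g (nextLive B p)
  open CodeOf public using (code)

  Codes : FunSet
  Codes φ = Σ Subset λ B → Σ (F B) λ p → φ ≡ code B p

  codes-avoidMiddles : AvoidsMiddles g Codes
  codes-avoidMiddles = infinitelyBelow , fewMiddles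
    where
      infinitelyBelow : ∀ φ → Codes φ → InfP (λ n → φ n < g n)
      infinitelyBelow _ (B , p , refl) =
        InfP-mono (λ (n∈B , pos) → CodeOf.S⇒code<g B p (n∈B , pos) pos) (large B p)

      middles : ∀ B B′ p p′ → Live B ⊆* Live B′ →
                FinP (λ n → code B p n < g n × g n ≤ code B′ p′ n)
      middles B B′ p p′ B⊆*B′ = ⊆*⇒finite-middles
        (⊆*-mono (CodeOf.code<g⇒S B p) (λ live → CodeOf.S⇒code<g B′ p′ live (proj₂ live)) B⊆*B′)

      fewMiddles : ∀ φ ψ → Codes φ → Codes ψ →
        FinP (λ n → φ n < g n × g n ≤ ψ n) ⊎ FinP (λ n → ψ n < g n × g n ≤ φ n)
      fewMiddles _ _ (B , p , refl) (B′ , p′ , refl) =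
        Sum.map (middles B B′ p p′) (middles B′ B p′ p) (linear B B′ p p′)

  -- If code B p n < H n with n outside B ∩ {g > 0}, the next live point n′ ≥ n
  -- has g n′ < H n ≤ H n′.
  escaping-codes⇒large : (H : ℕ → ℕ) → (∀ {m n} → m ≤ n → H m ≤ H n) →
    (∀ B p → InfP (λ n → code B p n < H n)) → Large F (λ n → g n ≤ H n)
  escaping-codes⇒large H H-mono escapes B p m with escapes B p m
  ... | n , m≤n , code<H with CodeOf.code<⇒ B p code<H
  ...   | inj₁ ((n∈B , _) , g≤H) = n , m≤n , n∈B , g≤H
  ...   | inj₂ g<H with large B p n
  ...     | n′ , n≤n′ , n′∈B , _ = n′ , ≤-trans m≤n n≤n′ , n′∈B , ≤-trans (<⇒≤ g<H) (H-mono n≤n′)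

belowAddXD⇒cond2 : ExcludedMiddle 0ℓ → ∀ K → BelowAddXD K → Cond2 K
belowAddXD⇒cond2 em K belowAdd g F _ hyps =
  H , λ α → escaping-codes⇒large α H (runningMax-mono h) (escapes α)
  where
    open module CodesOf α = Codes (g α) (F α) (proj₁ (hyps α)) (proj₂ (hyps α))

    unbounded : Σ (ℕ → ℕ) λ h → ∀ φ → (Σ K λ α → Codes α φ) → ¬ h ≤* φ
    unbounded = ¬dominating⇒unbounded em (belowAdd Codes λ α → g α , codes-avoidMiddles α)

    h H : ℕ → ℕ
    h = proj₁ unbounded
    H = runningMax h

    escapes : ∀ α B p → InfP (λ n → code α B p n < H n)
    escapes α B p = ≰*⇒infinitely-> em λ (m , H≤code) →
      proj₂ unbounded (code α B p) (α , B , p , refl)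
            (m , λ n m≤n → ≤-trans (runningMax-≥ h n) (H≤code n m≤n))

theorem4p6 : ExcludedMiddle 0ℓ → ExcludedMiddle (lsuc 0ℓ) →
    (K : Set) → BelowAddXD K ⇔ Cond2 K
theorem4p6 em _ K = mk⇔ (belowAddXD⇒cond2 em K) (cond2⇒belowAddXD K)
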